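{- For any $k\in\omega\setminus\{0\}$, $h^d(T_k)\ge k-1$.
   Context: Let $\omega=\{0,1,2,\ldots\}$, $\mathcal{P}(\omega)$ the set of nonempty finite subsets of $\omega$, $E_2=\{0,1\}$, and $P=\{f_i:i\in\omega\}$ a set of attributes. $\mathcal{M}_2^\infty$ is the set of rectangular tables filled with numbers from $E_2$ with pairwise different rows, each row labeled with a set from $\mathcal{P}(\omega)$ (its set of decisions), and columns labeled with pairwise different attributes from $P$ (the empty table $\Lambda$ included). For $T\in\mathcal{M}_2^\infty$, $\operatorname{At}(T)$ is its set of column attributes, $\Pi(T)$ the intersection of decision sets of its rows; for a word $\alpha=(f_{i_1},\delta_1)\cdots(f_{i_m},\delta_m)$, $T\alpha$ is the subtable of rows having $\delta_j$ in column $f_{i_j}$ for all $j$ ($T\lambda=T$ for the empty word $\lambda$). A $2$-decision tree is a finite directed rooted tree with at least two nodes, where the root and edges leaving it are unlabeled, terminal nodes are labeled with decisions from $\omega$, and every other node is labeled with an attribute from $P$, each edge leaving it labeled with a number from $E_2$. For a complete path $\tau=v_1,d_1,\ldots,v_m,d_m,v_{m+1}$ (root to a terminal node), $\pi(\tau)=\lambda$ if $m=1$, otherwise $\pi(\tau)=(f_{i_2},\delta_2)\cdots(f_{i_m},\delta_m)$ where $v_j$ is labeled $f_{i_j}$ and $d_j$ is labeled $\delta_j$; $T(\tau)=T\pi(\tau)$. For nonempty $T$, a deterministic decision tree for $T$ is a $2$-decision tree $\Gamma$ whose attributes lie in $\operatorname{At}(T)$, with exactly one edge leaving the root and pairwise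 differently labeled edges leaving each other nonterminal node, such that each row of $T$ belongs to $T(\tau)$ for some complete path $\tau$, and for each complete path $\tau$ either $T(\tau)=\Lambda$ or the decision at its terminal node lies in $\Pi(T(\tau))$. The depth of $\Gamma$ is the maximum length of $\pi(\tau)$ over complete paths, and $h^d(T)$ is the minimum depth of a deterministic decision tree for $T$. Graph $G_k$: for $k\ge1$ it has $m(k)=k(k+1)/2$ nodes arranged in layers $1,\ldots,k$, layer $i$ containing $i$ nodes $(i,1),\ldots,(i,i)$; node $(i,j)$ has number $(i-1)i/2+j$. For a node $(i,j)$ with $i<k$, its left child is $(i+1,j)$ and its right child is $(i+1,j+1)$; $l(x)$ and $p(x)$ denote the numbers of the left and right child of node number $x$. Define $\nu_k:E_2^{m(k)}\to\mathcal{P}(\omega)$: for $\bar\delta=(\delta_1,\ldots,\delta_{m(k)})$, $\nu_k(\bar\delta)\subseteq\{0,1,\ldots,m(k)\}$, where $0\in\nu_k(\bar\delta)$ iff $\delta_1=0$; for a node number $i$ not in layer $k$, $i\in\nu_k(\bar\delta)$ iff $\delta_i=1$ and $\delta_{l(i)}=\delta_{p(i)}=0$; for $i$ in layer $k$, $i\in\nu_k(\bar\delta)$ iff $\delta_i=1$. $T_k\in\mathcal{M}_2^\infty$ is the table with $m(k)$ columns labeled $f_1,\ldots,f_{m(k)}$ and all $2^{m(k)}$ rows of $E_2^{m(k)}$, each row $\bar\delta$ labeled with $\nu_k(\bar\delta)$. -}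

module Defs where

open import Data.Nat using (ℕ; zero; suc; _+_; _∸_; _≤_; _<_; _⊔_)
open import Data.Bool using (Bool; true; false)
open import Data.List using (List; []; _∷_; map; upTo)
open import Data.List.Membership.Propositional using (_∈_)
open import Data.List.Relation.Unary.All using (All)
open import Data.Vec using (Vec; []; _∷_)
open import Data.Product using (Σ; ∃; _×_; _,_)
open import Data.Sum using (_⊎_)
open import Data.Unit using (⊤)
open import Relation.Binary.PropositionalEquality using (_≡_)

-- Attribute f_i is represented by its index i : ℕ.
-- A table is given by its column attributes At, an index type of rows,
-- the value of each row in the column labelled f_i, and the set of
-- decisions of each row (as a predicate on ℕ).

record Table : Set₁ where
  field
    At   : List ℕ
    Row  : Set
    val  : Row → ℕ → Bool
    dec  : Row → ℕ → Set

open Table public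

Word : Set
Word = List (ℕ × Bool)

-- row r belongs to Tα
_⊨_ : (ℕ → Bool) → Word → Set
v ⊨ α = All (λ { (i , b) → v i ≡ b }) α

-- The (unlabelled) root has exactly one
-- outgoing edge, so a tree is represented by the subtree below the root.

data DTree : Set where
  leaf  : ℕ → DTree
  node2 : ℕ → DTree → DTree → DTree
  node1 : ℕ → Bool → DTree → DTree

-- Complete paths: Path Γ π d  means there is a complete path τ with
-- π(τ) = π whose terminal node is labelled d.
data Path : DTree → Word → ℕ → Set where
  leafP  : ∀ {d} → Path (leaf d) [] d
  node2₀ : ∀ {i t₀ t₁ w d} → Path t₀ w d → Path (node2 i t₀ t₁) ((i , false) ∷ w) d
  node2₁ : ∀ {i t₀ t₁ w d} → Path t₁ w d → Path (node2 i t₀ t₁) ((i , true) ∷ w) d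
  node1P : ∀ {i b t w d} → Path t w d → Path (node1 i b t) ((i , b) ∷ w) d

AttrsIn : List ℕ → DTree → Set
AttrsIn A (leaf d)        = ⊤
AttrsIn A (node2 i t₀ t₁) = i ∈ A × AttrsIn A t₀ × AttrsIn A t₁
AttrsIn A (node1 i b t)   = i ∈ A × AttrsIn A t

depth : DTree → ℕ
depth (leaf d)        = 0
depth (node2 i t₀ t₁) = suc (depth t₀ ⊔ depth t₁)
depth (node1 i b t)   = suc (depth t)

-- Γ is a deterministic decision tree for T.
-- "T(τ) = Λ or d ∈ Π(T(τ))" is: every row of T(τ) has d among its decisions.
record IsDDT (T : Table) (Γ : DTree) : Set where
  field
    attrs    : AttrsIn (At T) Γ
    covers   : (r : Row T) → Σ Word λ w → Σ ℕ λ d → Path Γ w d × (val T r ⊨ w)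
    correct  : ∀ {w d} → Path Γ w d → (r : Row T) → val T r ⊨ w → dec T r d

-- m(k) = k(k+1)/2
m : ℕ → ℕ
m zero    = 0
m (suc n) = suc n + m n

-- number of node (i , j):  (i-1)i/2 + j
num : ℕ → ℕ → ℕ
num i j = m (i ∸ 1) + j

-- 1-based lookup: component δ_i of a tuple (false outside 1..n)
look : ∀ {n} → Vec Bool n → ℕ → Bool
look []       _             = false
look (x ∷ xs) zero          = false
look (x ∷ xs) (suc zero)    = x
look (x ∷ xs) (suc (suc i)) = look xs (suc i)

_∈ν[_]_ : ℕ → ℕ → (ℕ → Bool) → Set
d ∈ν[ k ] δ =
    (d ≡ 0 × δ 1 ≡ false)
  ⊎ (Σ ℕ λ i → Σ ℕ λ j → 1 ≤ j × j ≤ i × i < k × d ≡ num i j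
       × δ d ≡ true × δ (num (suc i) j) ≡ false × δ (num (suc i) (suc j)) ≡ false)
  ⊎ (Σ ℕ λ j → 1 ≤ j × j ≤ k × d ≡ num k j × δ d ≡ true)

T : ℕ → Table
T k = record
  { At  = map suc (upTo (m k))
  ; Row = Vec Bool (m k)
  ; val = look
  ; dec = λ δ̄ d → d ∈ν[ k ] look δ̄
  }

module Submission where

-- The p-th deviation of a path leaves
-- it at step p and from then on keeps turning the other way; it ends at another bottom node, and
-- two deviations of the same path meet only on the path itself.  The adversary answers that the
-- queried node is off the path whenever some consistent path avoids it, and on the path
-- otherwise.  A forced answer keeps every deviation of a consistent path consistent, and an "off"
-- answer destroys at most one of them, since two destroyed deviations would both contain the
-- queried node and then so would the path.  So for every consistent path the number of
-- inconsistent deviations is at most the number of queries, and after fewer than k - 1 queries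
-- some consistent path still has a consistent deviation: no decision at a leaf fits both.

open import Defs
open import Data.Nat using (ℕ; zero; suc; _+_; _∸_; _≤_; _<_; z≤n; s≤s; s≤s⁻¹; _≟_; _≤?_)
open import Data.Nat.Properties
open import Data.Bool using (Bool; true; false; not)
open import Data.Bool.Properties using (¬-not; not-¬) renaming (_≟_ to _≟ᵇ_)
open import Data.List using (List; []; _∷_; map; length)
open import Data.List.Membership.Propositional using (_∈_)
open import Data.List.Membership.Propositional.Properties using (∈-map⁺; ∈-map⁻)
open import Data.List.Membership.DecPropositional _≟_ using (_∈?_)
open import Data.List.Relation.Unary.Any using (here; there)
open import Data.List.Relation.Unary.All using ([]; _∷_; all?)
open import Data.Vec using (Vec; []; _∷_; replicate)
open import Data.Fin.Subset.Properties using (anySubset?)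
open import Data.Product using (Σ; ∃; _×_; _,_; proj₁; proj₂; uncurry)
open import Data.Sum using (inj₁; inj₂)
open import Data.Empty using (⊥; ⊥-elim)
open import Level using (Level)
open import Relation.Unary using (Pred; Decidable)
open import Relation.Nullary using (Dec; yes; no; ¬_; does; contradiction)
open import Relation.Nullary.Decidable using (dec-true)
open import Relation.Binary using (tri<; tri≈; tri>)
open import Relation.Binary.PropositionalEquality

private
  variable
    ℓ ℓ′ : Level

count : {P : Pred ℕ ℓ} → Decidable P → ℕ → ℕ
count P? zero = 0
count P? (suc n) with P? n
... | yes _ = suc (count P? n)
... | no  _ = count P? n

module _ {P : Pred ℕ ℓ} (P? : Decidable P) where

  count-all : ∀ n → (∀ {p} → p < n → P p) → count P? n ≡ n
  count-all zero allP = refl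
  count-all (suc n) allP with P? n
  ... | yes _  = cong suc (count-all n (λ p<n → allP (m<n⇒m<1+n p<n)))
  ... | no ¬Pn = contradiction (allP ≤-refl) ¬Pn

  count-pos : ∀ n → 0 < count P? n → ∃ λ p → p < n × P p
  count-pos (suc n) pos with P? n
  ... | yes Pn = n , ≤-refl , Pn
  ... | no _ with count-pos n pos
  ...   | p , p<n , Pp = p , m<n⇒m<1+n p<n , Pp

module _ {P : Pred ℕ ℓ} {Q : Pred ℕ ℓ′} (P? : Decidable P) (Q? : Decidable Q) where

  count-mono : ∀ n → (∀ {p} → p < n → P p → Q p) → count P? n ≤ count Q? n
  count-mono zero P⇒Q = z≤n
  count-mono (suc n) P⇒Q with P? n | Q? n | count-mono n (λ p<n → P⇒Q (m<n⇒m<1+n p<n))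
  ... | yes Pn | no ¬Qn | _  = contradiction (P⇒Q ≤-refl Pn) ¬Qn
  ... | yes _  | yes _  | ih = s≤s ih
  ... | no _   | yes _  | ih = m≤n⇒m≤1+n ih
  ... | no _   | no _   | ih = ih

  count-≤-suc : ∀ n → (∀ {p q} → p < n → q < n → P p → ¬ Q p → P q → ¬ Q q → p ≡ q) →
                count P? n ≤ suc (count Q? n)
  count-≤-suc zero unique = z≤n
  count-≤-suc (suc n) unique
    with P? n | Q? n | count-≤-suc n (λ p<n q<n → unique (m<n⇒m<1+n p<n) (m<n⇒m<1+n q<n))
  ... | yes Pn | no ¬Qn | _ = s≤s (count-mono n only-n)
    where
    only-n : ∀ {p} → p < n → P p → Q p
    only-n {p} p<n Pp with Q? p
    ... | yes Qp = Qp
    ... | no ¬Qp = contradiction (unique (m<n⇒m<1+n p<n) ≤-refl Pp ¬Qp Pn ¬Qn) (<⇒≢ p<n)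
  ... | yes _ | yes _ | ih = s≤s ih
  ... | no _  | yes _ | ih = m≤n⇒m≤1+n ih
  ... | no _  | no _  | ih = ih

-- Adversary arguments for decision trees

record Decides (T : Table) (t : DTree) (α : Word) : Set where
  field
    covers  : (r : Row T) → val T r ⊨ α → Σ Word λ w → Σ ℕ λ d → Path t w d × val T r ⊨ w
    correct : ∀ {w d} → Path t w d → (r : Row T) → val T r ⊨ α → val T r ⊨ w → dec T r d

select : Bool → DTree → DTree → DTree
select false t₀ t₁ = t₀
select true  t₀ t₁ = t₁

depth-select : ∀ b i t₀ t₁ → suc (depth (select b t₀ t₁)) ≤ depth (node2 i t₀ t₁)
depth-select false i t₀ t₁ = s≤s (m≤m⊔n (depth t₀) (depth t₁))
depth-select true  i t₀ t₁ = s≤s (m≤n⊔m (depth t₀) (depth t₁))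

module _ {T : Table} {α : Word} {i : ℕ} where
  open Decides

  decides-node2 : ∀ b {t₀ t₁} → Decides T (node2 i t₀ t₁) α → Decides T (select b t₀ t₁) ((i , b) ∷ α)
  decides-node2 b D .covers r (vi ∷ c) with D .covers r c
  ... | _ , d , node2₀ p , vi′ ∷ s with refl ← trans (sym vi) vi′ = _ , d , p , s
  ... | _ , d , node2₁ p , vi′ ∷ s with refl ← trans (sym vi) vi′ = _ , d , p , s
  decides-node2 false D .correct p r (vi ∷ c) s = D .correct (node2₀ p) r c (vi ∷ s)
  decides-node2 true  D .correct p r (vi ∷ c) s = D .correct (node2₁ p) r c (vi ∷ s)

  node1-forced : ∀ {a b t} → Decides T (node1 i b t) α → (r : Row T) → val T r ⊨ ((i , a) ∷ α) → a ≡ b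
  node1-forced D r (vi ∷ c) with D .covers r c
  ... | _ , d , node1P p , vi′ ∷ s = trans (sym vi) vi′

  decides-node1 : ∀ {b t} → Decides T (node1 i b t) α → Decides T t ((i , b) ∷ α)
  decides-node1 D .covers r (vi ∷ c) with D .covers r c
  ... | _ , d , node1P p , _ ∷ s = _ , d , p , s
  decides-node1 D .correct p r (vi ∷ c) s = D .correct (node1P p) r c (vi ∷ s)

≤-suc-shift : ∀ {n} ℓ {d d′} → n ≤ suc ℓ + d → suc d ≤ d′ → n ≤ ℓ + d′
≤-suc-shift ℓ {d} n≤ d<d′ = ≤-trans n≤ (≤-trans (≤-reflexive (sym (+-suc ℓ d))) (+-monoʳ-≤ ℓ d<d′))

record Adversary (T : Table) (n : ℕ) : Set₁ where
  field
    Alive     : Word → Set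
    start     : Alive []
    answer    : ∀ {α} i → Alive α → Σ Bool λ b → Alive ((i , b) ∷ α)
    witness   : ∀ {α} → Alive α → Σ (Row T) λ r → val T r ⊨ α
    undecided : ∀ {α} → Alive α → length α < n → ∀ d → ¬ (∀ r → val T r ⊨ α → dec T r d)

module _ {T : Table} {n : ℕ} (A : Adversary T n) where
  open Adversary A

  adversary-bound : ∀ t {α} → Alive α → Decides T t α → n ≤ length α + depth t
  adversary-bound (leaf d) {α} alive D with n ≤? length α
  ... | yes n≤ℓ = ≤-trans n≤ℓ (m≤m+n (length α) 0)
  ... | no n≰ℓ  = contradiction (λ r c → Decides.correct D leafP r c []) (undecided alive (≰⇒> n≰ℓ) d)
  adversary-bound (node2 i t₀ t₁) {α} alive D with answer i alive
  ... | false , alive′ =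
    ≤-suc-shift (length α) (adversary-bound t₀ alive′ (decides-node2 false D)) (depth-select false i t₀ t₁)
  ... | true  , alive′ =
    ≤-suc-shift (length α) (adversary-bound t₁ alive′ (decides-node2 true D)) (depth-select true i t₀ t₁)
  adversary-bound (node1 i b t) {α} alive D with answer i alive
  ... | a , alive′ with refl ← uncurry (node1-forced D) (witness alive′) =
    ≤-suc-shift (length α) (adversary-bound t alive′ (decides-node1 D)) ≤-refl

  adversary-depth : ∀ {Γ} → IsDDT T Γ → n ≤ depth Γ
  adversary-depth {Γ} D = adversary-bound Γ start record
    { covers = λ r _ → IsDDT.covers D r ; correct = λ p r _ → IsDDT.correct D p r }

-- Descending paths in G_k

step : ℕ → Bool → ℕ
step j false = j
step j true  = suc j

pathFrom : ∀ {n} → ℕ → ℕ → Vec Bool n → List (ℕ × ℕ)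
pathFrom i j []       = (i , j) ∷ []
pathFrom i j (b ∷ ds) = (i , j) ∷ pathFrom (suc i) (step j b) ds

start∈pathFrom : ∀ {n} i j (ds : Vec Bool n) → (i , j) ∈ pathFrom i j ds
start∈pathFrom i j []      = here refl
start∈pathFrom i j (_ ∷ _) = here refl

pathFrom-layer : ∀ {n} i j (ds : Vec Bool n) {L c} → (L , c) ∈ pathFrom i j ds → L ≤ i + n
pathFrom-layer i j []       (here refl) = m≤m+n i 0
pathFrom-layer i j (b ∷ ds) (here refl) = m≤m+n i _
pathFrom-layer {suc n} i j (b ∷ ds) {L} (there x∈) =
  subst (L ≤_) (sym (+-suc i n)) (pathFrom-layer (suc i) (step j b) ds x∈)

pathFrom-column : ∀ {n} i j (ds : Vec Bool n) {L c} → (L , c) ∈ pathFrom i j ds → j ≤ c × c + i ≤ j + L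
pathFrom-column i j []       (here refl) = ≤-refl , ≤-refl
pathFrom-column i j (b ∷ ds) (here refl) = ≤-refl , ≤-refl
pathFrom-column i j (b ∷ ds) {L} {c} (there x∈) with pathFrom-column (suc i) (step j b) ds x∈
... | j′≤c , bound = ≤-trans (j≤step b) j′≤c , s≤s⁻¹ (begin
    suc (c + i)   ≡⟨ +-suc c i ⟨
    c + suc i     ≤⟨ bound ⟩
    step j b + L  ≤⟨ +-monoˡ-≤ L (step≤suc b) ⟩
    suc (j + L)   ∎)
  where
  open ≤-Reasoning
  j≤step : ∀ b → j ≤ step j b
  j≤step false = ≤-refl
  j≤step true  = n≤1+n j
  step≤suc : ∀ b → step j b ≤ suc j
  step≤suc false = n≤1+n j
  step≤suc true  = ≤-refl

straight-left : ∀ {n} i j {L c} → (L , c) ∈ pathFrom i j (replicate n false) → c ≡ j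
straight-left {zero}  i j (here refl) = refl
straight-left {suc n} i j (here refl) = refl
straight-left {suc n} i j (there x∈)  = straight-left (suc i) j x∈

straight-right : ∀ {n} i j {L c} → (L , c) ∈ pathFrom i j (replicate n true) → c + i ≡ j + L
straight-right {zero}  i j (here refl) = refl
straight-right {suc n} i j (here refl) = refl
straight-right {suc n} i j {L} {c} (there x∈) =
  suc-injective (trans (sym (+-suc c i)) (straight-right (suc i) (suc j) x∈))

turn-away-disjoint : ∀ {n} i j b (ds : Vec Bool n) {x} →
  x ∈ pathFrom i (step j (not b)) (replicate n (not b)) → x ∈ pathFrom i (step j b) ds → ⊥
turn-away-disjoint i j true ds x∈straight x∈path
  with refl ← straight-left i j x∈straight = 1+n≰n (proj₁ (pathFrom-column i (suc j) ds x∈path))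
turn-away-disjoint i j false ds {L , c} x∈straight x∈path =
  1+n≰n (subst (_≤ j + L) (straight-right i (suc j) x∈straight) (proj₂ (pathFrom-column i j ds x∈path)))

deviate : ∀ {n} → ℕ → Vec Bool n → Vec Bool n
deviate p       []       = []
deviate zero    (b ∷ ds) = not b ∷ replicate _ (not b)
deviate (suc p) (b ∷ ds) = b ∷ deviate p ds

deviate-meets-before : ∀ {n} p i j (ds : Vec Bool n) {L c} → p < n →
  (L , c) ∈ pathFrom i j ds → (L , c) ∈ pathFrom i j (deviate p ds) → L ≤ i + p
deviate-meets-before p       i j (b ∷ ds) _ (here refl) _           = m≤m+n i p
deviate-meets-before zero    i j (b ∷ ds) _ (there _)   (here refl) = m≤m+n i 0
deviate-meets-before (suc p) i j (b ∷ ds) _ (there _)   (here refl) = m≤m+n i (suc p)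
deviate-meets-before zero    i j (b ∷ ds) _ (there x∈) (there x∈′) =
  ⊥-elim (turn-away-disjoint (suc i) j b ds x∈′ x∈)
deviate-meets-before (suc p) i j (b ∷ ds) {L} (s≤s p<n) (there x∈) (there x∈′) =
  subst (L ≤_) (sym (+-suc i p)) (deviate-meets-before p (suc i) (step j b) ds p<n x∈ x∈′)

deviations-meet-on-path : ∀ {n} p q i j (ds : Vec Bool n) {x} → p < q →
  x ∈ pathFrom i j (deviate p ds) → x ∈ pathFrom i j (deviate q ds) → x ∈ pathFrom i j ds
deviations-meet-on-path p       q       i j []       _   x∈          _           = x∈
deviations-meet-on-path p       zero    i j (b ∷ ds) ()
deviations-meet-on-path zero    (suc q) i j (b ∷ ds) _   (here refl) _           = here refl
deviations-meet-on-path zero    (suc q) i j (b ∷ ds) _   (there _)   (here refl) = here refl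
deviations-meet-on-path (suc p) (suc q) i j (b ∷ ds) _   (here refl) _           = here refl
deviations-meet-on-path (suc p) (suc q) i j (b ∷ ds) _   (there _)   (here refl) = here refl
deviations-meet-on-path zero (suc q) i j (b ∷ ds) _ (there x∈) (there x∈′) =
  ⊥-elim (turn-away-disjoint (suc i) j b (deviate q ds) x∈ x∈′)
deviations-meet-on-path (suc p) (suc q) i j (b ∷ ds) (s≤s p<q) (there x∈) (there x∈′) =
  there (deviations-meet-on-path p q (suc i) (step j b) ds p<q x∈ x∈′)

pathFrom-next : ∀ {n} i j (ds : Vec Bool n) {L c} → (L , c) ∈ pathFrom i j ds → L < i + n →
  Σ Bool λ b → (suc L , step c b) ∈ pathFrom i j ds
pathFrom-next i j [] (here refl) L<i = contradiction (subst (i <_) (+-identityʳ i) L<i) (<-irrefl refl)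
pathFrom-next i j (b ∷ ds) (here refl) _ = b , there (start∈pathFrom (suc i) (step j b) ds)
pathFrom-next {suc n} i j (b ∷ ds) {L} (there x∈) L< with
  pathFrom-next (suc i) (step j b) ds x∈ (subst (L <_) (+-suc i n) L<)
... | b′ , next∈ = b′ , there next∈

m-mono : ∀ {a b} → a ≤ b → m a ≤ m b
m-mono z≤n       = z≤n
m-mono (s≤s a≤b) = +-mono-≤ (s≤s a≤b) (m-mono a≤b)

num≤m : ∀ L {c} → c ≤ L → num L c ≤ m L
num≤m zero    c≤0 = c≤0
num≤m (suc L) {c} c≤L = ≤-trans (+-monoʳ-≤ (m L) c≤L) (≤-reflexive (+-comm (m L) (suc L)))

num-<-layer : ∀ {L c L′ c′} → c ≤ L → 1 ≤ c′ → L < L′ → num L c < num L′ c′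
num-<-layer {L} {c} {suc L′} c≤L 1≤c′ (s≤s L≤L′) =
  ≤-<-trans (≤-trans (num≤m L c≤L) (m-mono L≤L′)) (m<m+n (m L′) 1≤c′)

num-injective : ∀ {L c L′ c′} → 1 ≤ c → c ≤ L → 1 ≤ c′ → c′ ≤ L′ →
  num L c ≡ num L′ c′ → (L , c) ≡ (L′ , c′)
num-injective {L} {c} {L′} {c′} 1≤c c≤L 1≤c′ c′≤L′ eq with <-cmp L L′
... | tri< L<L′ _ _ = contradiction eq (<⇒≢ (num-<-layer c≤L 1≤c′ L<L′))
... | tri> _ _ L′<L = contradiction (sym eq) (<⇒≢ (num-<-layer c′≤L′ 1≤c L′<L))
... | tri≈ _ refl _ = cong (L ,_) (+-cancelˡ-≡ (m (L ∸ 1)) c c′ eq)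

pathFrom-top-column : ∀ {n} (ds : Vec Bool n) {L c} → (L , c) ∈ pathFrom 1 1 ds → 1 ≤ c × c ≤ L
pathFrom-top-column ds {L} {c} x∈ with pathFrom-column 1 1 ds x∈
... | 1≤c , c+1≤1+L = 1≤c , s≤s⁻¹ (subst (_≤ suc L) (+-comm c 1) c+1≤1+L)

onPath : ∀ {n} → Vec Bool n → ℕ → Bool
onPath ds x = does (x ∈? map (uncurry num) (pathFrom 1 1 ds))

onPath-num : ∀ {n} (ds : Vec Bool n) {L c} → (L , c) ∈ pathFrom 1 1 ds → onPath ds (num L c) ≡ true
onPath-num ds x∈ = dec-true (_ ∈? _) (∈-map⁺ (uncurry num) x∈)

onPath⇒node : ∀ {n} (ds : Vec Bool n) {x} → onPath ds x ≡ true →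
  Σ ℕ λ L → Σ ℕ λ c → (L , c) ∈ pathFrom 1 1 ds × x ≡ num L c
onPath⇒node ds {x} on with x ∈? map (uncurry num) (pathFrom 1 1 ds)
... | yes x∈ with ∈-map⁻ (uncurry num) x∈
...   | (L , c) , node∈ , refl = L , c , node∈ , refl

onPath-num⇒node : ∀ {n} (ds : Vec Bool n) {L c} → 1 ≤ c → c ≤ L →
  onPath ds (num L c) ≡ true → (L , c) ∈ pathFrom 1 1 ds
onPath-num⇒node ds 1≤c c≤L on with onPath⇒node ds on
... | L′ , c′ , node∈ , eq with pathFrom-top-column ds node∈
...   | 1≤c′ , c′≤L′ with refl ← num-injective 1≤c c≤L 1≤c′ c′≤L′ eq = node∈

onPath-range : ∀ {n} (ds : Vec Bool n) {x} → onPath ds x ≡ true → 1 ≤ x × x ≤ m (suc n)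
onPath-range {n} ds on with onPath⇒node ds on
... | L , c , node∈ , refl with pathFrom-top-column ds node∈
...   | 1≤c , c≤L = ≤-trans 1≤c (m≤n+m c _) , ≤-trans (num≤m L c≤L) (m-mono (pathFrom-layer 1 1 ds node∈))

build : (n : ℕ) → (ℕ → Bool) → Vec Bool n
build zero    f = []
build (suc n) f = f 1 ∷ build n (λ x → f (suc x))

look-zero : ∀ {n} (v : Vec Bool n) → look v 0 ≡ false
look-zero []      = refl
look-zero (_ ∷ _) = refl

look-build : ∀ n f → (∀ x → n < x → f x ≡ false) → ∀ x → look (build n f) (suc x) ≡ f (suc x)
look-build zero    f outside x             = sym (outside (suc x) (s≤s z≤n))
look-build (suc n) f outside zero          = refl
look-build (suc n) f outside (suc x) =
  look-build n (λ x → f (suc x)) (λ x n<x → outside (suc x) (s≤s n<x)) x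

pathRow : ∀ {n} → Vec Bool n → Vec Bool (m (suc n))
pathRow {n} ds = build (m (suc n)) (onPath ds)

look-pathRow : ∀ {n} (ds : Vec Bool n) x → look (pathRow ds) x ≡ onPath ds x
look-pathRow ds zero    = trans (look-zero (pathRow ds)) (sym (¬-not λ on → 1+n≰n (proj₁ (onPath-range ds on))))
look-pathRow ds (suc x) = look-build _ (onPath ds)
  (λ y m<y → ¬-not λ on → <⇒≱ m<y (proj₂ (onPath-range ds on))) x

module _ {n} (ds : Vec Bool n) {δ : ℕ → Bool} (δ≗ : ∀ x → δ x ≡ onPath ds x) where

  private
    off-path : ∀ {x} → δ x ≡ false → onPath ds x ≡ true → ⊥
    off-path {x} δx on = contradiction (trans (sym δx) (trans (δ≗ x) on)) λ ()

  pathRow-decision : ∀ {d} → d ∈ν[ suc n ] δ → Σ ℕ λ j → (suc n , j) ∈ pathFrom 1 1 ds × d ≡ num (suc n) j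
  pathRow-decision (inj₁ (_ , δ1)) = ⊥-elim (off-path δ1 (onPath-num ds (start∈pathFrom 1 1 ds)))
  pathRow-decision (inj₂ (inj₁ (i , j , 1≤j , j≤i , i<k , refl , δd , δl , δr)))
    with pathFrom-next 1 1 ds (onPath-num⇒node ds 1≤j j≤i (trans (sym (δ≗ _)) δd)) i<k
  ... | false , next∈ = ⊥-elim (off-path δl (onPath-num ds next∈))
  ... | true  , next∈ = ⊥-elim (off-path δr (onPath-num ds next∈))
  pathRow-decision (inj₂ (inj₂ (j , 1≤j , j≤k , refl , δd))) =
    j , onPath-num⇒node ds 1≤j j≤k (trans (sym (δ≗ _)) δd) , refl

-- The adversary for T_k

m<n≤m+o⇒0<o : ∀ {m n o} → m < n → n ≤ m + o → 0 < o
m<n≤m+o⇒0<o {m} {o = o} m<n n≤m+o =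
  +-cancelˡ-< m 0 o (subst (_< m + o) (sym (+-identityʳ m)) (<-≤-trans m<n n≤m+o))

⊨-cong : ∀ {u v : ℕ → Bool} → (∀ x → u x ≡ v x) → ∀ {α} → u ⊨ α → v ⊨ α
⊨-cong u≗v {[]}          []       = []
⊨-cong u≗v {(i , b) ∷ α} (ui ∷ c) = trans (sym (u≗v i)) ui ∷ ⊨-cong u≗v c

onPath-deviations : ∀ {n} p q (ds : Vec Bool n) {x} → p < q →
  onPath (deviate p ds) x ≡ true → onPath (deviate q ds) x ≡ true → onPath ds x ≡ true
onPath-deviations p q ds p<q on₁ on₂ with onPath⇒node (deviate p ds) on₁
... | L , c , x∈₁ , refl with pathFrom-top-column (deviate p ds) x∈₁
...   | 1≤c , c≤L = onPath-num ds (deviations-meet-on-path p q 1 1 ds p<q x∈₁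
                      (onPath-num⇒node (deviate q ds) 1≤c c≤L on₂))

module PathAdversary (n : ℕ) where

  Consistent : Word → Vec Bool n → Set
  Consistent α ds = onPath ds ⊨ α

  consistent? : ∀ α ds → Dec (Consistent α ds)
  consistent? α ds = all? (λ { (i , b) → onPath ds i ≟ᵇ b }) α

  DeviationBound : Word → Set
  DeviationBound α = ∀ ds → Consistent α ds → n ≤ length α + count (λ p → consistent? α (deviate p ds)) n

  deviationBound-[] : DeviationBound []
  deviationBound-[] ds _ = ≤-reflexive (sym (count-all (λ p → consistent? [] (deviate p ds)) n (λ _ → [])))

  answer-false : ∀ {α i} → DeviationBound α → DeviationBound ((i , false) ∷ α)
  answer-false {α} {i} bound ds (off ∷ c) = begin
    n                                                  ≤⟨ bound ds c ⟩
    length α + count (consistent-deviation α) n        ≤⟨ +-monoʳ-≤ (length α) (count-≤-suc _ _ n unique) ⟩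
    length α + suc (count (consistent-deviation α′) n) ≡⟨ +-suc (length α) _ ⟩
    length α′ + count (consistent-deviation α′) n      ∎
    where
    open ≤-Reasoning
    α′ = (i , false) ∷ α
    consistent-deviation : ∀ β p → Dec (Consistent β (deviate p ds))
    consistent-deviation β p = consistent? β (deviate p ds)
    lost : ∀ v → Consistent α v → ¬ Consistent α′ v → onPath v i ≡ true
    lost _ c ¬c′ = ¬-not λ vi → ¬c′ (vi ∷ c)
    meet : ∀ {p q} → p < q → onPath (deviate p ds) i ≡ true → onPath (deviate q ds) i ≡ true → ⊥
    meet p<q on-p on-q = not-¬ off (onPath-deviations _ _ ds p<q on-p on-q)
    unique : ∀ {p q} → p < n → q < n →
      Consistent α (deviate p ds) → ¬ Consistent α′ (deviate p ds) →
      Consistent α (deviate q ds) → ¬ Consistent α′ (deviate q ds) → p ≡ q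
    unique {p} {q} _ _ cp ¬cp′ cq ¬cq′ with <-cmp p q
    ... | tri≈ _ p≡q _ = p≡q
    ... | tri< p<q _ _ = ⊥-elim (meet p<q (lost (deviate p ds) cp ¬cp′) (lost (deviate q ds) cq ¬cq′))
    ... | tri> _ _ q<p = ⊥-elim (meet q<p (lost (deviate q ds) cq ¬cq′) (lost (deviate p ds) cp ¬cp′))

  answer-forced : ∀ {α i} → DeviationBound α → (∀ ds → Consistent α ds → onPath ds i ≡ true) →
    DeviationBound ((i , true) ∷ α)
  answer-forced {α} bound forced ds (_ ∷ c) =
    ≤-trans (bound ds c)
            (+-mono-≤ (n≤1+n (length α)) (count-mono _ _ n λ {p} _ cp → forced (deviate p ds) cp ∷ cp))

  pathRow-consistent : ∀ {α} ds → Consistent α ds → look (pathRow ds) ⊨ α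
  pathRow-consistent ds = ⊨-cong (λ x → sym (look-pathRow ds x))

  consistent-decision : ∀ {α d} → (∀ r → look r ⊨ α → d ∈ν[ suc n ] look r) →
    ∀ ds → Consistent α ds → Σ ℕ λ j → (suc n , j) ∈ pathFrom 1 1 ds × d ≡ num (suc n) j
  consistent-decision decides ds c =
    pathRow-decision ds (look-pathRow ds) (decides (pathRow ds) (pathRow-consistent ds c))

  Alive : Word → Set
  Alive α = DeviationBound α × Σ (Vec Bool n) (Consistent α)

  answer : ∀ {α} i → Alive α → Σ Bool λ b → Alive ((i , b) ∷ α)
  answer {α} i (bound , ds₀ , c₀) with anySubset? (consistent? ((i , false) ∷ α))
  ... | yes (ds , c) = false , answer-false bound , ds , c
  ... | no none      = true , answer-forced bound forced , ds₀ , forced ds₀ c₀ ∷ c₀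
    where
    forced : ∀ ds → Consistent α ds → onPath ds i ≡ true
    forced ds c = ¬-not λ off → none (ds , off ∷ c)

  undecided : ∀ {α} → Alive α → length α < n → ∀ d → ¬ (∀ r → look r ⊨ α → d ∈ν[ suc n ] look r)
  undecided {α} (bound , ds , c) ℓ<n d decides
    with count-pos (λ p → consistent? α (deviate p ds)) n (m<n≤m+o⇒0<o ℓ<n (bound ds c))
  ... | p , p<n , cp with consistent-decision decides ds c | consistent-decision decides (deviate p ds) cp
  ... | j , j∈ , refl | j′ , j′∈ , eq with refl ← +-cancelˡ-≡ (m n) j j′ eq =
    <⇒≱ p<n (s≤s⁻¹ (deviate-meets-before p 1 1 ds p<n j∈ j′∈))

  pathAdversary : Adversary (T (suc n)) n
  pathAdversary = record
    { Alive     = Alive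
    ; start     = deviationBound-[] , replicate n false , []
    ; answer    = answer
    ; witness   = λ { (_ , ds , c) → pathRow ds , pathRow-consistent ds c }
    ; undecided = undecided
    }

lemma9 : (k : ℕ) → 1 ≤ k → (Γ : DTree) → IsDDT (T k) Γ → k ∸ 1 ≤ depth Γ
lemma9 zero    () Γ D
lemma9 (suc n) _  Γ D = adversary-depth (PathAdversary.pathAdversary n) D
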